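{- Let $L_u\subsetneq\{0,1,2,3\}$ and $L_v\subsetneq\{0,1,2,3\}$ with $L_u\cup L_v\ne\{0,1,2,3\}$. For any $a\in L_u$, $b\in L_v$ and $c\in\{0,1,2,3\}\setminus(L_u\cup L_v)$, there exists an $(a,b)$-forbidding $(u,v)$-path $(P,L)$ such that: (i) $L(u)=L_u$ and $L(v)=L_v$; (ii) $L(w)\subseteq\{0,1,2,3\}$ and $\#L(w)=2$ for each $w\in V(P)\setminus\{u,v\}$; (iii) $P$ has even length; (iv) $\bigcup_{w\in V(P)}L(w)=\{0,1,2,3\}$; (v) $c\in L(w)$ for each $w\in N_P(u)\cup N_P(v)$.
   Context: A list assignment $L$ of a graph assigns to each vertex $w$ a set $L(w)$ of colors; an $L$-coloring is a map $\gamma$ with $\gamma(w)\in L(w)$ for all $w$ and $\gamma(x)\ne\gamma(y)$ for every edge $xy$. A recoloring step changes the color of one vertex, producing another $L$-coloring. For a path $P$ with end-vertices $u,v$ and list assignment $L$, a $(c,d)$-coloring is an $L$-coloring $\gamma$ with $\gamma(u)=c$, $\gamma(v)=d$. For $a\in L(u)$, $b\in L(v)$, $(P,L)$ is an $(a,b)$-forbidding $(u,v)$-path if: (I) a $(c,d)$-coloring exists iff $(c,d)\ne(a,b)$ (for $c\in L(u)$, $d\in L(v)$); (II) whenever both a $(c,d)$-coloring and a $(c',d)$-coloring exist, from any $(c,d)$-coloring there is a sequence of recoloring steps ending in some $(c',d)$-coloring that never recolors $v$ and recolors $u$ only at the last step; (III) symmetrically, whenever both a $(c,d)$-coloring and a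 $(c,d')$-coloring exist, from any $(c,d)$-coloring there is a sequence of recoloring steps ending in some $(c,d')$-coloring that never recolors $u$ and recolors $v$ only at the last step. $N_P(x)$ denotes the neighbors of $x$ in $P$. -}

module Defs where

open import Data.Nat using (ℕ; zero; suc)
open import Data.Fin using (Fin; zero; suc; toℕ; fromℕ)
open import Data.Fin.Subset using (Subset; _∈_)
open import Data.Product using (Σ; ∃; _×_; _,_)
open import Data.Sum using (_⊎_)
open import Relation.Binary.PropositionalEquality using (_≡_; _≢_; _≗_)
open import Relation.Nullary using (¬_)

Colour : Set
Colour = Fin 4

-- The path P of length k: vertex set Fin (suc k), vertex i adjacent to i+1.
-- End-vertices: u = zero, v = fromℕ k.
Adj : ∀ {k} → Fin (suc k) → Fin (suc k) → Set
Adj x y = (toℕ y ≡ suc (toℕ x)) ⊎ (toℕ x ≡ suc (toℕ y))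

uEnd : ∀ {k} → Fin (suc k)
uEnd = zero

vEnd : ∀ {k} → Fin (suc k)
vEnd {k} = fromℕ k

ListAssignment : ℕ → Set
ListAssignment k = Fin (suc k) → Subset 4

Colouring : ℕ → Set
Colouring k = Fin (suc k) → Colour

IsLColouring : ∀ {k} → ListAssignment k → Colouring k → Set
IsLColouring {k} L γ =
  (∀ w → γ w ∈ L w) × (∀ (x y : Fin (suc k)) → Adj x y → γ x ≢ γ y)

IsCDColouring : ∀ {k} → ListAssignment k → Colour → Colour → Colouring k → Set
IsCDColouring L c d γ = IsLColouring L γ × γ uEnd ≡ c × γ vEnd ≡ d

HasCDColouring : ∀ {k} → ListAssignment k → Colour → Colour → Set
HasCDColouring {k} L c d = Σ (Colouring k) (IsCDColouring L c d)

Step : ∀ {k} → ListAssignment k → Fin (suc k) → Colouring k → Colouring k → Set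
Step L w γ δ =
  IsLColouring L γ × IsLColouring L δ × δ w ≢ γ w × (∀ x → x ≢ w → δ x ≡ γ x)

data Inner {k} (L : ListAssignment k) (γ : Colouring k) : Colouring k → Set where
  start : Inner L γ γ
  extend : ∀ {δ ε} w → w ≢ uEnd → w ≢ vEnd →
           Inner L γ δ → Step L w δ ε → Inner L γ ε

ReachU : ∀ {k} → ListAssignment k → Colouring k → Colour → Colour → Set
ReachU {k} L γ c' d =
  Σ (Colouring k) λ δ → Σ (Colouring k) λ ε →
    Inner L γ δ × (ε ≡ δ ⊎ Step L uEnd δ ε) × IsCDColouring L c' d ε

ReachV : ∀ {k} → ListAssignment k → Colouring k → Colour → Colour → Set
ReachV {k} L γ c d' =
  Σ (Colouring k) λ δ → Σ (Colouring k) λ ε →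
    Inner L γ δ × (ε ≡ δ ⊎ Step L vEnd δ ε) × IsCDColouring L c d' ε

Forbidding : ∀ {k} → ListAssignment k → Colour → Colour → Set
Forbidding {k} L a b =
  a ∈ L uEnd × b ∈ L vEnd ×
  (∀ c d → c ∈ L uEnd → d ∈ L vEnd →
     (HasCDColouring L c d → ¬ (c ≡ a × d ≡ b)) ×
     (¬ (c ≡ a × d ≡ b) → HasCDColouring L c d)) ×
  (∀ c c' d → HasCDColouring L c d → HasCDColouring L c' d →
     ∀ γ → IsCDColouring L c d γ → ReachU L γ c' d) ×
  (∀ c d d' → HasCDColouring L c d → HasCDColouring L c d' →
     ∀ γ → IsCDColouring L c d γ → ReachV L γ c d')

{-# OPTIONS --safe #-}

-- The path is u v₁ … v₅ v with L(vⱼ) = {tⱼ₋₁, tⱼ} for the sequence t = a c x y c b, where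
-- x, y are the two colours other than a and c, ordered so that y ≠ b. Consecutive lists
-- share a colour, so once some vⱼ takes its right colour tⱼ every later vertex must too:
-- the proper colourings of the interior are the six staircases (left colours up to some
-- position, right colours after it), and consecutive staircases differ at a single vertex.
-- Only the all-right staircase leaves a free at u (it has v₁ = c), but it has v₅ = b; only
-- the all-left one leaves b free at v, but it has v₁ = a. So (a, b) is the one unrealisable
-- pair, and recolouring u to a (v to b) is done by first sliding along the staircases to
-- the all-right (all-left) one, which is possible as long as u ≠ a and v ≠ b. This works
-- for any sequence with t₀ ∈ L(u) ∌ t₁ and tₙ ∈ L(v) ∌ tₙ₋₁ whose entries at distance one
-- and two are distinct.

module Submission where

open import Defs
open import Data.Nat using (ℕ; zero; suc; _≤_; _*_; s≤s; z≤n) renaming (_≟_ to _≟ℕ_)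
import Data.Nat as Nat
open import Data.Fin using (Fin; zero; suc; toℕ; inject₁; fromℕ; _≟_)
open import Data.Fin.Properties
  using (all?; any?; toℕ-inject₁; toℕ-injective; suc-injective; fromℕ≢inject₁)
open import Data.Fin.Subset using (Subset; _∈_; _∉_; _⊂_; _∪_; ⊤; ∣_∣; ⁅_⁆)
open import Data.Fin.Subset.Properties using (x∈⁅x⁆; x∈⁅y⁆⇒x≡y; x∈p∪q⁻; x∈p∪q⁺)
open import Data.Vec.Functional using (_∷_; [])
open import Data.Product using (Σ; ∃; ∃₂; _×_; _,_; map₂)
open import Data.Sum using (_⊎_; inj₁; inj₂)
import Data.Sum as Sum
open import Data.Empty using (⊥-elim)
open import Function using (_∘_)
open import Relation.Binary.PropositionalEquality
  using (_≡_; _≢_; _≗_; refl; sym; trans; cong; subst; subst₂; module ≡-Reasoning)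
open import Relation.Nullary using (¬_; yes; no)
open import Relation.Nullary.Decidable using (_×-dec_; _⊎-dec_; _→-dec_; from-yes; ¬?)

pair : Colour → Colour → Subset 4
pair p q = ⁅ p ⁆ ∪ ⁅ q ⁆

∈-pairˡ : ∀ p q → p ∈ pair p q
∈-pairˡ p q = x∈p∪q⁺ (inj₁ (x∈⁅x⁆ p))

∈-pairʳ : ∀ p q → q ∈ pair p q
∈-pairʳ p q = x∈p∪q⁺ (inj₂ (x∈⁅x⁆ q))

∈-pair⁻ : ∀ {z} p q → z ∈ pair p q → z ≡ p ⊎ z ≡ q
∈-pair⁻ p q z∈ with x∈p∪q⁻ ⁅ p ⁆ ⁅ q ⁆ z∈
... | inj₁ z∈p = inj₁ (x∈⁅y⁆⇒x≡y p z∈p)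
... | inj₂ z∈q = inj₂ (x∈⁅y⁆⇒x≡y q z∈q)

∣pair∣≡2 : ∀ p q → p ≢ q → ∣ pair p q ∣ ≡ 2
∣pair∣≡2 = from-yes (all? λ p → all? λ q → ¬? (p ≟ q) →-dec (∣ pair p q ∣ ≟ℕ 2))

∈∉⇒≢ : ∀ {x y} {S : Subset 4} → x ∈ S → y ∉ S → x ≢ y
∈∉⇒≢ x∈S y∉S refl = y∉S x∈S

consecutive-adjacent : ∀ {k} (i : Fin k) → Adj (inject₁ i) (suc i)
consecutive-adjacent i = inj₁ (cong Nat.suc (sym (toℕ-inject₁ i)))

toℕ-suc⇒consecutive : ∀ {k} (x y : Fin (suc k)) → toℕ y ≡ suc (toℕ x) →
                      ∃ λ i → x ≡ inject₁ i × y ≡ suc i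
toℕ-suc⇒consecutive {suc k} zero (suc zero) refl = zero , refl , refl
toℕ-suc⇒consecutive {suc k} (suc x) (suc y) eq with toℕ-suc⇒consecutive x y (cong Nat.pred eq)
... | i , refl , refl = suc i , refl , refl

adjacent-zero : ∀ {n} {w : Fin (suc (suc n))} → Adj zero w → w ≡ suc zero
adjacent-zero (inj₁ eq) = toℕ-injective eq

adjacent-fromℕ : ∀ {n} {w : Fin (suc (suc n))} → Adj (fromℕ (suc n)) w → w ≡ inject₁ (fromℕ n)
adjacent-fromℕ {n} {w} (inj₁ eq) with toℕ-suc⇒consecutive (fromℕ (suc n)) w eq
... | i , last≡i , _ = ⊥-elim (fromℕ≢inject₁ last≡i)
adjacent-fromℕ {n} {w} (inj₂ eq) with toℕ-suc⇒consecutive w (fromℕ (suc n)) eq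
... | i , w≡i , last≡i = trans w≡i (cong inject₁ (sym (suc-injective last≡i)))

module _ {k : ℕ} {L : ListAssignment k} where

  isLColouring : ∀ {γ} → (∀ w → γ w ∈ L w) → (∀ i → γ (inject₁ i) ≢ γ (suc i)) →
                 IsLColouring L γ
  isLColouring {γ} γ∈L consecutive≢ = γ∈L , proper
    where
    proper : ∀ x y → Adj x y → γ x ≢ γ y
    proper x y (inj₁ eq) with toℕ-suc⇒consecutive x y eq
    ... | i , refl , refl = consecutive≢ i
    proper x y (inj₂ eq) with toℕ-suc⇒consecutive y x eq
    ... | i , refl , refl = consecutive≢ i ∘ sym

  IsLColouring-resp : ∀ {γ δ} → γ ≗ δ → IsLColouring L δ → IsLColouring L γ
  IsLColouring-resp γ≗δ (δ∈L , proper) =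
    (λ w → subst (_∈ L w) (sym (γ≗δ w)) (δ∈L w)) ,
    (λ x y x~y eq → proper x y x~y (trans (sym (γ≗δ x)) (trans eq (γ≗δ y))))

  Step-sym : ∀ {w γ δ} → Step L w γ δ → Step L w δ γ
  Step-sym (γ-ok , δ-ok , δw≢γw , agree) = δ-ok , γ-ok , δw≢γw ∘ sym , λ x x≢w → sym (agree x x≢w)

  Step-resp : ∀ {w γ γ' δ} → γ' ≗ γ → Step L w γ δ → Step L w γ' δ
  Step-resp γ'≗γ (γ-ok , δ-ok , δw≢γw , agree) =
    IsLColouring-resp γ'≗γ γ-ok , δ-ok ,
    (λ eq → δw≢γw (trans eq (γ'≗γ _))) , (λ x x≢w → trans (agree x x≢w) (sym (γ'≗γ x)))

  InnerStep : Colouring k → Colouring k → Set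
  InnerStep γ δ = Σ (Fin (suc k)) λ w → w ≢ uEnd × w ≢ vEnd × Step L w γ δ

  InnerStep-sym : ∀ {γ δ} → InnerStep γ δ → InnerStep δ γ
  InnerStep-sym (w , w≢u , w≢v , step) = w , w≢u , w≢v , Step-sym step

  inner-cons : ∀ {γ δ ε} → InnerStep γ δ → Inner L δ ε → Inner L γ ε
  inner-cons (w , w≢u , w≢v , step) start = extend w w≢u w≢v start step
  inner-cons s (extend w w≢u w≢v walk step) = extend w w≢u w≢v (inner-cons s walk) step

  Inner-resp : ∀ {γ γ' ε} → γ ≗ γ' → Inner L γ' ε → ∃ λ ε' → Inner L γ ε' × ε' ≗ ε
  Inner-resp {γ} γ≗γ' start = γ , start , γ≗γ'
  Inner-resp γ≗γ' (extend w w≢u w≢v walk step) with Inner-resp γ≗γ' walk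
  ... | δ' , walk' , δ'≗δ = _ , extend w w≢u w≢v walk' (Step-resp δ'≗δ step) , λ _ → refl

  walk-then-step-resp : ∀ {γ γ' δ ε w} → γ ≗ γ' → Inner L γ' δ → Step L w δ ε →
                        ∃ λ δ' → Inner L γ δ' × Step L w δ' ε
  walk-then-step-resp γ≗γ' walk step with Inner-resp γ≗γ' walk
  ... | δ' , walk' , δ'≗δ = δ' , walk' , Step-resp δ'≗δ step

  chain-to-first : ∀ {n} (σ : Fin (suc n) → Colouring k) →
                   (∀ i → InnerStep (σ (inject₁ i)) (σ (suc i))) → ∀ i → Inner L (σ i) (σ zero)
  chain-to-first σ steps zero = start
  chain-to-first {suc n} σ steps (suc i) =
    inner-cons (InnerStep-sym (steps i)) (chain-to-first (σ ∘ inject₁) (steps ∘ inject₁) i)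

  chain-to-last : ∀ {n} (σ : Fin (suc n) → Colouring k) →
                  (∀ i → InnerStep (σ (inject₁ i)) (σ (suc i))) → ∀ i → Inner L (σ i) (σ (fromℕ n))
  chain-to-last {zero} σ steps zero = start
  chain-to-last {suc n} σ steps zero = inner-cons (steps zero) (chain-to-last (σ ∘ suc) (steps ∘ suc) zero)
  chain-to-last {suc n} σ steps (suc i) = chain-to-last (σ ∘ suc) (steps ∘ suc) i

data Position {n : ℕ} : Fin (suc (suc n)) → Set where
  first : Position zero
  inner : ∀ j → Position (suc (inject₁ j))
  last  : Position (fromℕ (suc n))

position : ∀ {n} (w : Fin (suc (suc n))) → Position w
position zero = first
position {zero} (suc zero) = last
position {suc n} (suc w) with position w
... | first = inner zero
... | inner j = inner (suc j)
... | last = last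

module _ {A : Set} where

  -- p on u, σ j on the interior vertex suc (inject₁ j), r on v.
  frame : ∀ {n} → A → (Fin n → A) → A → Fin (suc (suc n)) → A
  frame p σ r zero = p
  frame {zero} p σ r (suc zero) = r
  frame {suc n} p σ r (suc w) = frame (σ zero) (σ ∘ suc) r w

  frame-inner : ∀ {n} p (σ : Fin n → A) r j → frame p σ r (suc (inject₁ j)) ≡ σ j
  frame-inner {suc n} p σ r zero = refl
  frame-inner {suc n} p σ r (suc j) = frame-inner (σ zero) (σ ∘ suc) r j

  frame-last : ∀ {n} p (σ : Fin n → A) r → frame p σ r (fromℕ (suc n)) ≡ r
  frame-last {zero} p σ r = refl
  frame-last {suc n} p σ r = frame-last (σ zero) (σ ∘ suc) r

  frame-proper : ∀ {m} {p r} {σ : Fin (suc m) → A} → p ≢ σ zero →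
                 (∀ j → σ (inject₁ j) ≢ σ (suc j)) → σ (fromℕ m) ≢ r →
                 ∀ i → frame p σ r (inject₁ i) ≢ frame p σ r (suc i)
  frame-proper p≢first _ _ zero = p≢first
  frame-proper {zero} _ _ last≢r (suc zero) = last≢r
  frame-proper {suc m} _ σ≢ last≢r (suc i) = frame-proper (σ≢ zero) (σ≢ ∘ suc) last≢r i

  frame-agree : ∀ {n} {p p' r r' : A} {σ σ' : Fin n → A} w →
                (w ≡ zero → p ≡ p') → (∀ j → w ≡ suc (inject₁ j) → σ j ≡ σ' j) →
                (w ≡ fromℕ (suc n) → r ≡ r') → frame p σ r w ≡ frame p' σ' r' w
  frame-agree {p = p} {p'} {r} {r'} {σ} {σ'} w agree-p agree-σ agree-r with position w
  ... | first = agree-p refl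
  ... | inner j = trans (frame-inner p σ r j) (trans (agree-σ j refl) (sym (frame-inner p' σ' r' j)))
  ... | last = trans (frame-last p σ r) (trans (agree-r refl) (sym (frame-last p' σ' r')))

  ≗-frame : ∀ {n} {p r : A} {σ : Fin n → A} {γ : Fin (suc (suc n)) → A} →
            γ zero ≡ p → (∀ j → γ (suc (inject₁ j)) ≡ σ j) → γ (fromℕ (suc n)) ≡ r →
            γ ≗ frame p σ r
  ≗-frame {p = p} {r} {σ} γ-first γ-inner γ-last w with position w
  ... | first = γ-first
  ... | inner j = trans (γ-inner j) (sym (frame-inner p σ r j))
  ... | last = trans γ-last (sym (frame-last p σ r))

module _ {A B : Set} where

  frame-pointwise : ∀ {n} (R : A → B → Set) {p P r Q} {σ : Fin n → A} {S : Fin n → B} →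
                    R p P → (∀ j → R (σ j) (S j)) → R r Q → ∀ w → R (frame p σ r w) (frame P S Q w)
  frame-pointwise R {p} {P} {r} {Q} {σ} {S} Rp Rσ Rr w with position w
  ... | first = Rp
  ... | inner j = subst₂ R (sym (frame-inner p σ r j)) (sym (frame-inner P S Q j)) (Rσ j)
  ... | last = subst₂ R (sym (frame-last p σ r)) (sym (frame-last P S Q)) Rr

module _ {A : Set} where

  -- The interior vertex j, with list {t (inject₁ j), t (suc j)}, gets the left colour iff j < i.
  staircase : ∀ {n} → (Fin (suc n) → A) → Fin (suc n) → Fin n → A
  staircase t zero j = t (suc j)
  staircase t (suc i) zero = t zero
  staircase t (suc i) (suc j) = staircase (t ∘ suc) i j

  staircase-choice : ∀ {n} (t : Fin (suc n) → A) i j →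
                     staircase t i j ≡ t (inject₁ j) ⊎ staircase t i j ≡ t (suc j)
  staircase-choice t zero j = inj₂ refl
  staircase-choice t (suc i) zero = inj₁ refl
  staircase-choice t (suc i) (suc j) = staircase-choice (t ∘ suc) i j

  staircase-fromℕ : ∀ {n} (t : Fin (suc n) → A) j → staircase t (fromℕ n) j ≡ t (inject₁ j)
  staircase-fromℕ t zero = refl
  staircase-fromℕ t (suc j) = staircase-fromℕ (t ∘ suc) j

  staircase-proper : ∀ {m} {t : Fin (suc (suc m)) → A} →
                     (∀ j → t (inject₁ j) ≢ t (suc j)) →
                     (∀ j → t (inject₁ (inject₁ j)) ≢ t (suc (suc j))) →
                     ∀ i j → staircase t i (inject₁ j) ≢ staircase t i (suc j)
  staircase-proper t≢ _ zero j = t≢ (suc j)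
  staircase-proper t≢ t≢₂ (suc zero) zero = t≢₂ zero
  staircase-proper t≢ _ (suc (suc i)) zero = t≢ zero
  staircase-proper t≢ t≢₂ (suc i) (suc j) = staircase-proper (t≢ ∘ suc) (t≢₂ ∘ suc) i j

  staircase-step-agree : ∀ {n} (t : Fin (suc n) → A) i j → j ≢ i →
                         staircase t (suc i) j ≡ staircase t (inject₁ i) j
  staircase-step-agree t zero zero j≢i = ⊥-elim (j≢i refl)
  staircase-step-agree t zero (suc j) _ = refl
  staircase-step-agree t (suc i) zero _ = refl
  staircase-step-agree t (suc i) (suc j) j≢i =
    staircase-step-agree (t ∘ suc) i j (j≢i ∘ cong suc)

  staircase-step-before : ∀ {n} (t : Fin (suc n) → A) i → staircase t (inject₁ i) i ≡ t (suc i)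
  staircase-step-before t zero = refl
  staircase-step-before t (suc i) = staircase-step-before (t ∘ suc) i

  staircase-step-after : ∀ {n} (t : Fin (suc n) → A) i → staircase t (suc i) i ≡ t (inject₁ i)
  staircase-step-after t zero = refl
  staircase-step-after t (suc i) = staircase-step-after (t ∘ suc) i

  staircase-classify : ∀ {m} (t : Fin (suc (suc m)) → A) (σ : Fin (suc m) → A) →
                       (∀ j → σ j ≡ t (inject₁ j) ⊎ σ j ≡ t (suc j)) →
                       (∀ j → σ (inject₁ j) ≢ σ (suc j)) →
                       ∃ λ i → σ ≗ staircase t i
  staircase-classify t σ choice proper with choice zero
  ... | inj₂ σ₀-right = zero , all-right t σ choice proper σ₀-right
    where
    all-right : ∀ {m} (t : Fin (suc (suc m)) → A) (σ : Fin (suc m) → A) →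
                (∀ j → σ j ≡ t (inject₁ j) ⊎ σ j ≡ t (suc j)) →
                (∀ j → σ (inject₁ j) ≢ σ (suc j)) →
                σ zero ≡ t (suc zero) → ∀ j → σ j ≡ t (suc j)
    all-right t σ _ _ σ₀-right zero = σ₀-right
    all-right {suc m} t σ choice proper σ₀-right (suc j) with choice (suc zero)
    ... | inj₁ σ₁-left = ⊥-elim (proper zero (trans σ₀-right (sym σ₁-left)))
    ... | inj₂ σ₁-right = all-right (t ∘ suc) (σ ∘ suc) (choice ∘ suc) (proper ∘ suc) σ₁-right j
  staircase-classify {zero} t σ _ _ | inj₁ σ₀-left = suc zero , λ { zero → σ₀-left }
  staircase-classify {suc m} t σ choice proper | inj₁ σ₀-left
    with staircase-classify (t ∘ suc) (σ ∘ suc) (choice ∘ suc) (proper ∘ suc)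
  ... | i , σ≗ = suc i , λ { zero → σ₀-left ; (suc j) → σ≗ j }

module StaircaseGadget {m : ℕ} (t : Fin (suc (suc m)) → Colour) (Lu Lv : Subset 4)
  (t-adjacent≢ : ∀ j → t (inject₁ j) ≢ t (suc j))
  (t-gap≢ : ∀ j → t (inject₁ (inject₁ j)) ≢ t (suc (suc j)))
  (t-first∈Lu : t zero ∈ Lu) (t-second∉Lu : t (suc zero) ∉ Lu)
  (t-last∈Lv : t (fromℕ (suc m)) ∈ Lv) (t-penultimate∉Lv : t (inject₁ (fromℕ m)) ∉ Lv)
  where

  open ≡-Reasoning

  a b : Colour
  a = t zero
  b = t (fromℕ (suc m))

  pairs : Fin (suc m) → Subset 4
  pairs j = pair (t (inject₁ j)) (t (suc j))

  lists : ListAssignment (suc (suc m))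
  lists = frame Lu pairs Lv

  lists-last : lists vEnd ≡ Lv
  lists-last = frame-last Lu pairs Lv

  state : Fin (suc (suc m)) → Colour → Colour → Colouring (suc (suc m))
  state i p r = frame p (staircase t i) r

  staircase-∈ : ∀ i j → staircase t i j ∈ pairs j
  staircase-∈ i j with staircase-choice t i j
  ... | inj₁ left = subst (_∈ pairs j) (sym left) (∈-pairˡ _ _)
  ... | inj₂ right = subst (_∈ pairs j) (sym right) (∈-pairʳ _ _)

  state-valid : ∀ i {p r} → p ∈ Lu → r ∈ Lv →
                p ≢ staircase t i zero → staircase t i (fromℕ m) ≢ r →
                IsLColouring lists (state i p r)
  state-valid i p∈Lu r∈Lv p≢first last≢r =
    isLColouring (frame-pointwise _∈_ p∈Lu (staircase-∈ i) r∈Lv)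
                 (frame-proper p≢first (staircase-proper t-adjacent≢ t-gap≢ i) last≢r)

  state-ends : ∀ i {p r} → IsLColouring lists (state i p r) →
               p ∈ Lu × r ∈ Lv × p ≢ staircase t i zero × staircase t i (fromℕ m) ≢ r
  state-ends i {p} {r} (∈lists , proper) =
    ∈lists zero ,
    subst (_∈ Lv) (frame-last p (staircase t i) r) (subst (_ ∈_) lists-last (∈lists vEnd)) ,
    proper zero (suc zero) (consecutive-adjacent {suc (suc m)} zero) ,
    λ last≡r → proper (suc (inject₁ (fromℕ m))) vEnd (consecutive-adjacent (suc (fromℕ m)))
                 (trans (frame-inner p (staircase t i) r (fromℕ m))
                        (trans last≡r (sym (frame-last p (staircase t i) r))))

  avoids-first : ∀ {p} → p ∈ Lu → p ≢ a → ∀ i → p ≢ staircase t i zero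
  avoids-first p∈Lu p≢a i with staircase-choice t i zero
  ... | inj₁ left = λ p≡ → p≢a (trans p≡ left)
  ... | inj₂ right = λ p≡ → ∈∉⇒≢ p∈Lu t-second∉Lu (trans p≡ right)

  avoids-last : ∀ {r} → r ∈ Lv → r ≢ b → ∀ i → staircase t i (fromℕ m) ≢ r
  avoids-last r∈Lv r≢b i with staircase-choice t i (fromℕ m)
  ... | inj₁ left = λ ≡r → ∈∉⇒≢ r∈Lv t-penultimate∉Lv (trans (sym ≡r) left)
  ... | inj₂ right = λ ≡r → r≢b (trans (sym ≡r) right)

  state-valid-all : ∀ {p r} → p ∈ Lu → r ∈ Lv → p ≢ a → r ≢ b →
                    ∀ i → IsLColouring lists (state i p r)
  state-valid-all p∈Lu r∈Lv p≢a r≢b i =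
    state-valid i p∈Lu r∈Lv (avoids-first p∈Lu p≢a i) (avoids-last r∈Lv r≢b i)

  state-step : ∀ {p r} → p ∈ Lu → r ∈ Lv → p ≢ a → r ≢ b → ∀ i →
               InnerStep {L = lists} (state (inject₁ i) p r) (state (suc i) p r)
  state-step {p} {r} p∈Lu r∈Lv p≢a r≢b i =
    suc (inject₁ i) , (λ ()) , (λ w≡v → fromℕ≢inject₁ (sym (suc-injective w≡v))) ,
    valid (inject₁ i) , valid (suc i) , recoloured , unchanged
    where
    valid = state-valid-all p∈Lu r∈Lv p≢a r≢b
    recoloured : state (suc i) p r (suc (inject₁ i)) ≢ state (inject₁ i) p r (suc (inject₁ i))
    recoloured eq = t-adjacent≢ i (begin
      t (inject₁ i)                             ≡⟨ sym (staircase-step-after t i) ⟩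
      staircase t (suc i) i                     ≡⟨ sym (frame-inner p (staircase t (suc i)) r i) ⟩
      state (suc i) p r (suc (inject₁ i))       ≡⟨ eq ⟩
      state (inject₁ i) p r (suc (inject₁ i))   ≡⟨ frame-inner p (staircase t (inject₁ i)) r i ⟩
      staircase t (inject₁ i) i                 ≡⟨ staircase-step-before t i ⟩
      t (suc i)                                 ∎)
    unchanged : ∀ w → w ≢ suc (inject₁ i) → state (suc i) p r w ≡ state (inject₁ i) p r w
    unchanged w w≢ =
      frame-agree {σ = staircase t (suc i)} {σ' = staircase t (inject₁ i)} w (λ _ → refl)
        (λ j w≡ → staircase-step-agree t i j (λ j≡i → w≢ (trans w≡ (cong (suc ∘ inject₁) j≡i))))
        (λ _ → refl)

  walk-to-first : ∀ {p r} → p ∈ Lu → r ∈ Lv → p ≢ a → r ≢ b →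
                  ∀ i → Inner lists (state i p r) (state zero p r)
  walk-to-first {p} {r} p∈Lu r∈Lv p≢a r≢b =
    chain-to-first (λ i → state i p r) (state-step p∈Lu r∈Lv p≢a r≢b)

  walk-to-last : ∀ {p r} → p ∈ Lu → r ∈ Lv → p ≢ a → r ≢ b →
                 ∀ i → Inner lists (state i p r) (state (fromℕ (suc m)) p r)
  walk-to-last {p} {r} p∈Lu r∈Lv p≢a r≢b =
    chain-to-last (λ i → state i p r) (state-step p∈Lu r∈Lv p≢a r≢b)

  recolour-first : ∀ i {p p' r} → IsLColouring lists (state i p r) → IsLColouring lists (state i p' r) →
                   p' ≢ p → Step lists uEnd (state i p r) (state i p' r)
  recolour-first i valid valid' p'≢p =
    valid , valid' , p'≢p ,
    λ w w≢u → frame-agree w (⊥-elim ∘ w≢u) (λ _ _ → refl) (λ _ → refl)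

  recolour-last : ∀ i {p r r'} → IsLColouring lists (state i p r) → IsLColouring lists (state i p r') →
                  r' ≢ r → Step lists vEnd (state i p r) (state i p r')
  recolour-last i {p} {r} {r'} valid valid' r'≢r =
    valid , valid' ,
    (λ eq → r'≢r (trans (sym (frame-last p (staircase t i) r'))
                        (trans eq (frame-last p (staircase t i) r)))) ,
    λ w w≢v → frame-agree w (λ _ → refl) (λ _ _ → refl) (⊥-elim ∘ w≢v)

  state-cd : ∀ i {p r} → IsLColouring lists (state i p r) → IsCDColouring lists p r (state i p r)
  state-cd i {p} {r} valid = valid , refl , frame-last p (staircase t i) r

  classify : ∀ {p r γ} → IsCDColouring lists p r γ → ∃ λ i → γ ≗ state i p r
  classify {p} {r} {γ} ((∈lists , proper) , γ-first , γ-last) =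
    map₂ (λ σ≗ → ≗-frame γ-first σ≗ γ-last)
         (staircase-classify t (γ ∘ suc ∘ inject₁) choice consecutive≢)
    where
    choice : ∀ j → γ (suc (inject₁ j)) ≡ t (inject₁ j) ⊎ γ (suc (inject₁ j)) ≡ t (suc j)
    choice j = ∈-pair⁻ _ _ (subst (_ ∈_) (frame-inner Lu pairs Lv j) (∈lists (suc (inject₁ j))))
    consecutive≢ : ∀ j → γ (suc (inject₁ (inject₁ j))) ≢ γ (suc (suc (inject₁ j)))
    consecutive≢ j = proper _ _ (consecutive-adjacent (suc (inject₁ j)))

  classified-valid : ∀ i {p r γ} → IsCDColouring lists p r γ → γ ≗ state i p r →
                     IsLColouring lists (state i p r)
  classified-valid i (valid , _) γ≗ = IsLColouring-resp (sym ∘ γ≗) valid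

  forbidden-unrealisable : ∀ {γ} → ¬ IsCDColouring lists a b γ
  forbidden-unrealisable cd with classify cd
  ... | zero , γ≗ =
    let _ , _ , _ , last≢b = state-ends zero (classified-valid zero cd γ≗) in last≢b refl
  ... | suc i , γ≗ =
    let _ , _ , a≢first , _ = state-ends (suc i) (classified-valid (suc i) cd γ≗) in a≢first refl

  realisable : ∀ {p r} → p ∈ Lu → r ∈ Lv → ¬ (p ≡ a × r ≡ b) → HasCDColouring lists p r
  realisable {p} {r} p∈Lu r∈Lv not-ab with p ≟ a
  ... | yes refl =
    state zero p r ,
    state-cd zero (state-valid zero p∈Lu r∈Lv (∈∉⇒≢ p∈Lu t-second∉Lu)
                                (λ b≡r → not-ab (refl , sym b≡r)))
  ... | no p≢a =
    state (fromℕ (suc m)) p r ,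
    state-cd (fromℕ (suc m)) (state-valid (fromℕ (suc m)) p∈Lu r∈Lv p≢a
      (λ ≡r → ∈∉⇒≢ r∈Lv t-penultimate∉Lv (trans (sym ≡r) (staircase-fromℕ t (fromℕ m)))))

  reach-by-first : ∀ i {p r p'} → IsLColouring lists (state i p r) → p' ∈ Lu → p' ≢ p →
                   (p' ≡ a → r ≢ b) →
                   ∃₂ λ δ ε → Inner lists (state i p r) δ × Step lists uEnd δ ε ×
                              IsCDColouring lists p' r ε
  reach-by-first i {p} {r} {p'} valid p'∈Lu p'≢p r-allowed with state-ends i valid | p' ≟ a
  ... | p∈Lu , r∈Lv , _ , _ | yes refl =
    state zero p r , state zero a r , walk-to-first p∈Lu r∈Lv (p'≢p ∘ sym) r≢b i ,
    recolour-first zero (state-valid-all p∈Lu r∈Lv (p'≢p ∘ sym) r≢b zero) valid-a p'≢p ,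
    state-cd zero valid-a
    where
    r≢b = r-allowed refl
    valid-a = state-valid zero p'∈Lu r∈Lv (∈∉⇒≢ p'∈Lu t-second∉Lu) (r≢b ∘ sym)
  ... | _ , r∈Lv , _ , last≢r | no p'≢a =
    state i p r , state i p' r , start , recolour-first i valid valid' p'≢p , state-cd i valid'
    where valid' = state-valid i p'∈Lu r∈Lv (avoids-first p'∈Lu p'≢a i) last≢r

  reach-by-last : ∀ i {p r r'} → IsLColouring lists (state i p r) → r' ∈ Lv → r' ≢ r →
                  (r' ≡ b → p ≢ a) →
                  ∃₂ λ δ ε → Inner lists (state i p r) δ × Step lists vEnd δ ε ×
                             IsCDColouring lists p r' ε
  reach-by-last i {p} {r} {r'} valid r'∈Lv r'≢r p-allowed with state-ends i valid | r' ≟ b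
  ... | p∈Lu , r∈Lv , _ , _ | yes refl =
    state top p r , state top p b , walk-to-last p∈Lu r∈Lv p≢a (r'≢r ∘ sym) i ,
    recolour-last top (state-valid-all p∈Lu r∈Lv p≢a (r'≢r ∘ sym) top) valid-b r'≢r ,
    state-cd top valid-b
    where
    top = fromℕ (suc m)
    p≢a = p-allowed refl
    valid-b = state-valid top p∈Lu r'∈Lv p≢a
                (λ ≡b → t-adjacent≢ (fromℕ m) (trans (sym (staircase-fromℕ t (fromℕ m))) ≡b))
  ... | p∈Lu , _ , p≢first , _ | no r'≢b =
    state i p r , state i p r' , start , recolour-last i valid valid' r'≢r , state-cd i valid'
    where valid' = state-valid i p∈Lu r'∈Lv p≢first (avoids-last r'∈Lv r'≢b i)

  forbidding : Forbidding lists a b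
  forbidding = t-first∈Lu , subst (b ∈_) (sym lists-last) t-last∈Lv , realisability , reachU , reachV
    where
    realisability : ∀ p r → p ∈ Lu → r ∈ lists vEnd →
                    (HasCDColouring lists p r → ¬ (p ≡ a × r ≡ b)) ×
                    (¬ (p ≡ a × r ≡ b) → HasCDColouring lists p r)
    realisability p r p∈Lu r∈lists =
      (λ { (_ , cd) (refl , refl) → forbidden-unrealisable cd }) ,
      realisable p∈Lu (subst (r ∈_) lists-last r∈lists)

    reachU : ∀ p p' r → HasCDColouring lists p r → HasCDColouring lists p' r →
             ∀ γ → IsCDColouring lists p r γ → ReachU lists γ p' r
    reachU p p' r _ (_ , cd'@((∈lists' , _) , first' , _)) γ cd with p' ≟ p | classify cd
    ... | yes refl | _ = γ , γ , start , inj₁ refl , cd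
    ... | no p'≢p | i , γ≗
      with reach-by-first i (classified-valid i cd γ≗) (subst (_∈ Lu) first' (∈lists' uEnd)) p'≢p
             (λ { refl refl → forbidden-unrealisable cd' })
    ... | δ , ε , walk , step , ε-cd with walk-then-step-resp γ≗ walk step
    ... | δ' , walk' , step' = δ' , ε , walk' , inj₂ step' , ε-cd

    reachV : ∀ p r r' → HasCDColouring lists p r → HasCDColouring lists p r' →
             ∀ γ → IsCDColouring lists p r γ → ReachV lists γ p r'
    reachV p r r' _ (_ , cd'@((∈lists' , _) , _ , last')) γ cd with r' ≟ r | classify cd
    ... | yes refl | _ = γ , γ , start , inj₁ refl , cd
    ... | no r'≢r | i , γ≗
      with reach-by-last i (classified-valid i cd γ≗)
             (subst (_∈ Lv) last' (subst (_ ∈_) lists-last (∈lists' vEnd))) r'≢r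
             (λ { refl refl → forbidden-unrealisable cd' })
    ... | δ , ε , walk , step , ε-cd with walk-then-step-resp γ≗ walk step
    ... | δ' , walk' , step' = δ' , ε , walk' , inj₂ step' , ε-cd

  lists-interior-size : ∀ w → w ≢ uEnd → w ≢ vEnd → ∣ lists w ∣ ≡ 2
  lists-interior-size w w≢u w≢v with position w
  ... | first = ⊥-elim (w≢u refl)
  ... | inner j = trans (cong ∣_∣ (frame-inner Lu pairs Lv j)) (∣pair∣≡2 _ _ (t-adjacent≢ j))
  ... | last = ⊥-elim (w≢v refl)

  second-listed-next-to-u : ∀ w → Adj uEnd w → t (suc zero) ∈ lists w
  second-listed-next-to-u w adj rewrite adjacent-zero adj = ∈-pairʳ _ _

  penultimate-listed-next-to-v : ∀ w → Adj vEnd w → t (inject₁ (fromℕ m)) ∈ lists w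
  penultimate-listed-next-to-v w adj rewrite adjacent-fromℕ adj =
    subst (_ ∈_) (sym (frame-inner Lu pairs Lv (fromℕ m))) (∈-pairˡ _ _)

  lists-cover : (∀ z → ∃ λ j → t j ≡ z) → ∀ z → Σ (Fin (suc (suc (suc m)))) λ w → z ∈ lists w
  lists-cover t-onto z with t-onto z
  ... | zero , refl = suc zero , ∈-pairˡ _ _
  ... | suc j , refl = suc (inject₁ j) , subst (_ ∈_) (sym (frame-inner Lu pairs Lv j)) (∈-pairʳ _ _)

Complement : Colour → Colour → Set
Complement a c = Σ Colour λ x → Σ Colour λ y →
  a ≢ x × a ≢ y × c ≢ x × c ≢ y × x ≢ y × (∀ z → z ≡ a ⊎ z ≡ c ⊎ z ≡ x ⊎ z ≡ y)

-- Opaque, so that the decision procedure is not unfolded wherever a witness is used.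
opaque
  complement : ∀ a c → a ≢ c → Complement a c
  complement = from-yes (all? λ (a : Colour) → all? λ (c : Colour) → ¬? (a ≟ c) →-dec
    any? λ x → any? λ y →
      ¬? (a ≟ x) ×-dec ¬? (a ≟ y) ×-dec ¬? (c ≟ x) ×-dec ¬? (c ≟ y) ×-dec ¬? (x ≟ y) ×-dec
      all? λ z → (z ≟ a) ⊎-dec (z ≟ c) ⊎-dec (z ≟ x) ⊎-dec (z ≟ y))

record Palette (a b c : Colour) : Set where
  field
    x y : Colour
    c≢x : c ≢ x
    x≢y : x ≢ y
    y≢c : y ≢ c
    a≢x : a ≢ x
    y≢b : y ≢ b
    covered : ∀ z → z ≡ a ⊎ z ≡ c ⊎ z ≡ x ⊎ z ≡ y

complement-ordered : ∀ {a c} b → Complement a c → Palette a b c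
complement-ordered b (x , y , a≢x , a≢y , c≢x , c≢y , x≢y , covered) with y ≟ b
... | no y≢b = record
  { x = x ; y = y ; c≢x = c≢x ; x≢y = x≢y ; y≢c = c≢y ∘ sym ; a≢x = a≢x ; y≢b = y≢b
  ; covered = covered }
... | yes refl = record
  { x = y ; y = x ; c≢x = c≢y ; x≢y = x≢y ∘ sym ; y≢c = c≢x ∘ sym ; a≢x = a≢y ; y≢b = x≢y
  ; covered = Sum.map₂ (Sum.map₂ Sum.swap) ∘ covered }

palette : ∀ a b c → a ≢ c → Palette a b c
palette a b c a≢c = complement-ordered b (complement a c a≢c)

module _ {a b c : Colour} (P : Palette a b c) where

  open Palette P

  palette-sequence : Fin 6 → Colour
  palette-sequence = a ∷ c ∷ x ∷ y ∷ c ∷ b ∷ []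

  palette-sequence-adjacent≢ : a ≢ c → b ≢ c →
                               ∀ j → palette-sequence (inject₁ j) ≢ palette-sequence (suc j)
  palette-sequence-adjacent≢ a≢c _ zero = a≢c
  palette-sequence-adjacent≢ _ _ (suc zero) = c≢x
  palette-sequence-adjacent≢ _ _ (suc (suc zero)) = x≢y
  palette-sequence-adjacent≢ _ _ (suc (suc (suc zero))) = y≢c
  palette-sequence-adjacent≢ _ b≢c (suc (suc (suc (suc zero)))) = b≢c ∘ sym

  palette-sequence-gap≢ : ∀ j → palette-sequence (inject₁ (inject₁ j)) ≢ palette-sequence (suc (suc j))
  palette-sequence-gap≢ zero = a≢x
  palette-sequence-gap≢ (suc zero) = y≢c ∘ sym
  palette-sequence-gap≢ (suc (suc zero)) = c≢x ∘ sym
  palette-sequence-gap≢ (suc (suc (suc zero))) = y≢b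

  palette-sequence-onto : ∀ z → ∃ λ j → palette-sequence j ≡ z
  palette-sequence-onto z with covered z
  ... | inj₁ refl = zero , refl
  ... | inj₂ (inj₁ refl) = suc zero , refl
  ... | inj₂ (inj₂ (inj₁ refl)) = suc (suc zero) , refl
  ... | inj₂ (inj₂ (inj₂ refl)) = suc (suc (suc zero)) , refl

-- The hypotheses Lu ⊂ ⊤, Lv ⊂ ⊤ and Lu ∪ Lv ≢ ⊤ only serve to make c exist.
mainTheorem16 : (Lu Lv : Subset 4) → Lu ⊂ ⊤ → Lv ⊂ ⊤ → Lu ∪ Lv ≢ ⊤ →
    (a b c : Colour) → a ∈ Lu → b ∈ Lv → c ∉ Lu ∪ Lv →
    Σ ℕ λ k → Σ (ListAssignment k) λ L →
      1 ≤ k × Forbidding L a b ×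
      (L uEnd ≡ Lu × L vEnd ≡ Lv) ×
      (∀ w → w ≢ uEnd → w ≢ vEnd → ∣ L w ∣ ≡ 2) ×
      (Σ ℕ λ m → k ≡ 2 * m) ×
      (∀ (x : Colour) → Σ (Fin _) λ w → x ∈ L w) ×
      (∀ w → Adj uEnd w ⊎ Adj vEnd w → c ∈ L w)
mainTheorem16 Lu Lv _ _ _ a b c a∈Lu b∈Lv c∉Lu∪Lv =
  6 , lists , s≤s z≤n , forbidding , (refl , refl) , lists-interior-size , (3 , refl) ,
  lists-cover (palette-sequence-onto P) ,
  λ { w (inj₁ adj) → second-listed-next-to-u w adj ; w (inj₂ adj) → penultimate-listed-next-to-v w adj }
  where
  c∉Lu : c ∉ Lu
  c∉Lu = c∉Lu∪Lv ∘ x∈p∪q⁺ ∘ inj₁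
  c∉Lv : c ∉ Lv
  c∉Lv = c∉Lu∪Lv ∘ x∈p∪q⁺ ∘ inj₂
  P : Palette a b c
  P = palette a b c (∈∉⇒≢ a∈Lu c∉Lu)
  open StaircaseGadget (palette-sequence P) Lu Lv
    (palette-sequence-adjacent≢ P (∈∉⇒≢ a∈Lu c∉Lu) (∈∉⇒≢ b∈Lv c∉Lv))
    (palette-sequence-gap≢ P)
    a∈Lu c∉Lu b∈Lv c∉Lv
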